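{- Let $G$ be a pertinent group and suppose $G$ has a normal $2$-subgroup $H$ of order $2^m$. Then $m$ is even.
   Context: A finite group is pertinent if it has exactly three involutions and these three involutions are pairwise conjugate in the group. -}

module Defs where

open import Data.Nat using (ℕ)
open import Data.Fin using (Fin)
open import Data.Fin.Subset using (Subset; _∈_)
open import Data.Product using (Σ; ∃; _×_; _,_)
open import Data.Sum using (_⊎_)
open import Relation.Nullary using (¬_)
open import Relation.Binary.PropositionalEquality using (_≡_; _≢_)
open import Algebra.Core using (Op₁; Op₂)
open import Algebra.Structures using (IsGroup)

-- A finite group of order n, presented (up to isomorphism) on the carrier
-- Fin n with propositional equality, using the library's IsGroup.
record FiniteGroup : Set where
  field
    order   : ℕ
    _∙_     : Op₂ (Fin order)
    ε       : Fin order
    _⁻¹     : Op₁ (Fin order)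
    isGroup : IsGroup _≡_ _∙_ ε _⁻¹

module _ (G : FiniteGroup) where
  open FiniteGroup G

  IsInvolution : Fin order → Set
  IsInvolution x = (x ≢ ε) × (x ∙ x ≡ ε)

  Conjugate : Fin order → Fin order → Set
  Conjugate x y = ∃ λ g → (g ∙ x) ∙ (g ⁻¹) ≡ y

  Pertinent : Set
  Pertinent =
    (Σ (Fin order) λ a → Σ (Fin order) λ b → Σ (Fin order) λ c →
        IsInvolution a × IsInvolution b × IsInvolution c ×
        (a ≢ b) × (a ≢ c) × (b ≢ c) ×
        (∀ x → IsInvolution x → (x ≡ a) ⊎ (x ≡ b) ⊎ (x ≡ c)))
    × (∀ x y → IsInvolution x → IsInvolution y → Conjugate x y)

  IsSubgroup : Subset order → Set
  IsSubgroup H =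
    (ε ∈ H) ×
    (∀ x y → x ∈ H → y ∈ H → (x ∙ y) ∈ H) ×
    (∀ x → x ∈ H → (x ⁻¹) ∈ H)

  IsNormalSubgroup : Subset order → Set
  IsNormalSubgroup H =
    IsSubgroup H × (∀ g h → h ∈ H → ((g ∙ h) ∙ (g ⁻¹)) ∈ H)

module Submission where

-- Some conjugation permutes the three involutions cyclically, and it preserves H ∖ {1}. Every
-- u ∈ H ∖ {1} has an involution among its powers, since the order of u divides |H| = 2^m; a
-- power of the conjugation fixing u fixes that involution, so its exponent is a multiple of 3.
-- Hence every orbit of the conjugation on H ∖ {1} has length divisible by 3, so 3 ∣ 2^m − 1,
-- which forces m to be even. Both divisibilities are instances of one counting fact: if every
-- period of every point of an invariant set T of a permutation is a multiple of d, then d ∣ |T|.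

open import Defs
open import Level using (0ℓ)
open import Algebra.Bundles using (Group)
open import Algebra.Structures using (IsGroup)
import Algebra.Properties.Group
import Algebra.Properties.Monoid.Mult

open import Data.Nat using (ℕ; zero; suc; _+_; _*_; _^_; _≤_; _<_; s≤s; s≤s⁻¹; z≤n)
open import Data.Nat.Coprimality using (Coprime; coprime-divisor)
open import Data.Nat.Primality using (irreducible[2])
open import Data.Nat.Tactic.RingSolver using (solve-∀)
open import Data.Nat.Properties
  using (+-suc; +-comm; suc-injective; ≤-refl; ≤-trans; <⇒≤; n<1+n; m<m+n; m≤n+m; m≤n⇒m≤1+n;
         m<n⇒m<1+n; m<1+n⇒m<n∨m≡n; m≤n⇒∃[o]m+o≡n; anyUpTo?)
open import Data.Nat.Induction using (<-rec; <-wellFounded)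
open import Data.Nat.Divisibility using (_∣_; divides; _∣?_; _∣0; ∣-refl; ∣1⇒≡1; ∣m∣n⇒∣m+n; m%n≡0⇒n∣m)
open import Data.Nat.DivMod using (_%_; _/_; m≡m%n+[m/n]*n; m%n<n; [m+kn]%n≡m%n)
open import Data.Fin using (Fin; zero; suc; toℕ)
open import Data.Fin.Properties using (pigeonhole; _≟_)
open import Data.Fin.Subset
open import Data.Fin.Subset.Properties
open import Data.Product using (∃; _×_; _,_; proj₁; proj₂)
open import Data.Sum using (_⊎_; inj₁; inj₂; map₂; swap)
open import Data.Vec using ([]; _∷_; here; there)
open import Function using (_∘_; flip)
open import Function.Definitions using (Injective)
open import Induction.WellFounded using (Acc; acc)
open import Relation.Nullary using (¬_; yes; no; contradiction)
open import Relation.Unary using (Pred; Decidable)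
open import Relation.Binary.PropositionalEquality

∣p∣≡∣p─q∣+∣q∣ : ∀ {n} {p q : Subset n} → q ⊆ p → ∣ p ∣ ≡ ∣ p ─ q ∣ + ∣ q ∣
∣p∣≡∣p─q∣+∣q∣ {p = []}          {[]}          _   = refl
∣p∣≡∣p─q∣+∣q∣ {p = s ∷ p}       {outside ∷ q} q⊆p with s
... | inside  = cong suc (∣p∣≡∣p─q∣+∣q∣ (drop-∷-⊆ q⊆p))
... | outside = ∣p∣≡∣p─q∣+∣q∣ (drop-∷-⊆ q⊆p)
∣p∣≡∣p─q∣+∣q∣ {p = inside ∷ p}  {inside ∷ q}  q⊆p =
  trans (cong suc (∣p∣≡∣p─q∣+∣q∣ (drop-∷-⊆ q⊆p))) (sym (+-suc _ _))
∣p∣≡∣p─q∣+∣q∣ {p = outside ∷ p} {inside ∷ q}  q⊆p with () ← q⊆p here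

x∉p⇒∣⁅x⁆∪p∣≡1+∣p∣ : ∀ {n} {x : Fin n} {p : Subset n} → x ∉ p → ∣ ⁅ x ⁆ ∪ p ∣ ≡ suc ∣ p ∣
x∉p⇒∣⁅x⁆∪p∣≡1+∣p∣ {x = zero}  {outside ∷ p} _   = cong suc (cong ∣_∣ (∪-identityˡ p))
x∉p⇒∣⁅x⁆∪p∣≡1+∣p∣ {x = zero}  {inside ∷ p}  x∉p with () ← x∉p here
x∉p⇒∣⁅x⁆∪p∣≡1+∣p∣ {x = suc x} {outside ∷ p} x∉p = x∉p⇒∣⁅x⁆∪p∣≡1+∣p∣ (x∉p ∘ there)
x∉p⇒∣⁅x⁆∪p∣≡1+∣p∣ {x = suc x} {inside ∷ p}  x∉p = cong suc (x∉p⇒∣⁅x⁆∪p∣≡1+∣p∣ (x∉p ∘ there))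

x∈p─q⇒x∉q : ∀ {n} {x : Fin n} (p q : Subset n) → x ∈ p ─ q → x ∉ q
x∈p─q⇒x∉q (_ ∷ p) (_ ∷ q)      (there x∈p─q) (there x∈q) = x∈p─q⇒x∉q p q x∈p─q x∈q
x∈p─q⇒x∉q (_ ∷ p) (inside ∷ q) () here

x∈p-y⁻ : ∀ {n} {p : Subset n} {x y} → x ∈ p - y → x ∈ p × x ≢ y
x∈p-y⁻ {p = p} {y = y} x∈p-y = p─q⊆p p ⁅ y ⁆ x∈p-y , x∉⁅y⁆⇒x≢y (x∈p─q⇒x∉q p ⁅ y ⁆ x∈p-y)

x∈p⇒∣p∣≡1+∣p-x∣ : ∀ {n} {p : Subset n} {x} → x ∈ p → ∣ p ∣ ≡ suc ∣ p - x ∣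
x∈p⇒∣p∣≡1+∣p-x∣ {p = p} {x} x∈p =
  trans (∣p∣≡∣p─q∣+∣q∣ ⁅x⁆⊆p) (trans (cong (∣ p - x ∣ +_) (∣⁅x⁆∣≡1 x)) (+-comm ∣ p - x ∣ 1))
  where
  ⁅x⁆⊆p : ⁅ x ⁆ ⊆ p
  ⁅x⁆⊆p y∈⁅x⁆ = subst (_∈ p) (sym (x∈⁅y⁆⇒x≡y x y∈⁅x⁆)) x∈p

IsLeast : ∀ {p} → Pred ℕ p → ℕ → Set p
IsLeast P m = P m × (∀ {t} → t < m → ¬ P t)

least-witness : ∀ {p} {P : Pred ℕ p} → Decidable P → ∀ {k} → P k → ∃ (IsLeast P)
least-witness {P = P} P? {k} = <-rec (λ k → P k → ∃ (IsLeast P)) least k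
  where
  least : ∀ k → (∀ {t} → t < k → P t → ∃ (IsLeast P)) → P k → ∃ (IsLeast P)
  least k rec Pk with anyUpTo? P? k
  ... | yes (t , t<k , Pt) = rec t<k Pt
  ... | no ∄t = k , Pk , λ t<k Pt → ∄t (_ , t<k , Pt)

module Orbits {n : ℕ} (β : Fin n → Fin n) (β-injective : Injective _≡_ _≡_ β) where

  open import Function.Endo.Propositional (Fin n) using (^-homo) renaming (_^_ to _^ᶠ_)

  ^ᶠ-+ : ∀ a b z → (β ^ᶠ (a + b)) z ≡ (β ^ᶠ a) ((β ^ᶠ b) z)
  ^ᶠ-+ a b = cong-app (^-homo β a b)

  ^ᶠ-injective : ∀ k → Injective _≡_ _≡_ (β ^ᶠ k)
  ^ᶠ-injective zero    eq = eq
  ^ᶠ-injective (suc k) eq = ^ᶠ-injective k (β-injective eq)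

  Period : Fin n → ℕ → Set
  Period z k = (β ^ᶠ k) z ≡ z

  period? : ∀ z → Decidable (Period z ∘ suc)
  period? z t = (β ^ᶠ suc t) z ≟ z

  Invariant : Subset n → Set
  Invariant T = ∀ {x} → x ∈ T → β x ∈ T

  period-difference : ∀ {z} i k → (β ^ᶠ (i + k)) z ≡ (β ^ᶠ i) z → Period z k
  period-difference {z} i k eq = ^ᶠ-injective i (trans (sym (^ᶠ-+ i k z)) eq)

  period-exists : ∀ z → ∃ λ k → Period z (suc k)
  period-exists z with i , j , i<j , eq ← pigeonhole (n<1+n n) (λ i → (β ^ᶠ toℕ i) z)
                  with k , i+1+k≡j ← m≤n⇒∃[o]m+o≡n i<j =
    k , period-difference (toℕ i) (suc k)
          (trans (cong (λ m → (β ^ᶠ m) z) (trans (+-suc (toℕ i) k) i+1+k≡j)) (sym eq))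

  least-period : ∀ z → ∃ (IsLeast (Period z ∘ suc))
  least-period z with k , p ← period-exists z = least-witness (period? z) {k} p

  period-* : ∀ {z k} → Period z k → ∀ m → Period z (m * k)
  period-* p zero = refl
  period-* {z} {k} p (suc m) = trans (^ᶠ-+ k (m * k) z) (trans (cong (β ^ᶠ k) (period-* p m)) p)

  orbit : Fin n → ℕ → Subset n
  orbit z zero    = ⊥
  orbit z (suc k) = ⁅ (β ^ᶠ k) z ⁆ ∪ orbit z k

  ∈-orbit⁻ : ∀ {x z} k → x ∈ orbit z k → ∃ λ i → i < k × (β ^ᶠ i) z ≡ x
  ∈-orbit⁻ zero    x∈ = contradiction x∈ ∉⊥
  ∈-orbit⁻ {z = z} (suc k) x∈ with x∈p∪q⁻ ⁅ (β ^ᶠ k) z ⁆ (orbit z k) x∈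
  ... | inj₁ x∈⁅βᵏz⁆ = k , ≤-refl , sym (x∈⁅y⁆⇒x≡y _ x∈⁅βᵏz⁆)
  ... | inj₂ x∈orbit with i , i<k , eq ← ∈-orbit⁻ k x∈orbit = i , m≤n⇒m≤1+n i<k , eq

  ∈-orbit⁺ : ∀ z {i k} → i < k → (β ^ᶠ i) z ∈ orbit z k
  ∈-orbit⁺ z {i} {suc k} i<1+k with m<1+n⇒m<n∨m≡n i<1+k
  ... | inj₁ i<k  = x∈p∪q⁺ (inj₂ (∈-orbit⁺ z i<k))
  ... | inj₂ refl = x∈p∪q⁺ (inj₁ (x∈⁅x⁆ _))

  orbit-⊆ : ∀ {T z} → Invariant T → z ∈ T → ∀ k → orbit z k ⊆ T
  orbit-⊆ {T} {z} inv z∈T k x∈ with i , _ , refl ← ∈-orbit⁻ k x∈ = iterate-∈ i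
    where
    iterate-∈ : ∀ i → (β ^ᶠ i) z ∈ T
    iterate-∈ zero    = z∈T
    iterate-∈ (suc i) = inv (iterate-∈ i)

  orbit-closed-β⁻¹ : ∀ {z q x} → Period z (suc q) → β x ∈ orbit z (suc q) → x ∈ orbit z (suc q)
  orbit-closed-β⁻¹ {z} {q} {x} per βx∈ with ∈-orbit⁻ (suc q) βx∈
  ... | zero  , _     , z≡βx  = subst (_∈ orbit z (suc q)) (β-injective (trans per z≡βx)) (∈-orbit⁺ z {q} ≤-refl)
  ... | suc i , 1+i<1+q , eq  = subst (_∈ orbit z (suc q)) (β-injective eq) (∈-orbit⁺ z (m<n⇒m<1+n (s≤s⁻¹ 1+i<1+q)))

  module _ {z q} (least : IsLeast (Period z ∘ suc) q) where

    period≤q⇒≡0 : ∀ {r} → r ≤ q → Period z r → r ≡ 0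
    period≤q⇒≡0 {zero}  _         _ = refl
    period≤q⇒≡0 {suc t} 1+t≤q p = contradiction p (proj₂ least 1+t≤q)

    least-period-∣ : ∀ {N} → Period z N → suc q ∣ N
    least-period-∣ {N} pN = m%n≡0⇒n∣m N (suc q) (period≤q⇒≡0 (s≤s⁻¹ (m%n<n N (suc q))) remainder)
      where
      open ≡-Reasoning
      r = N % suc q
      remainder : Period z r
      remainder = begin
        (β ^ᶠ r) z                                   ≡⟨ cong (β ^ᶠ r) (period-* (proj₁ least) (N / suc q)) ⟨
        (β ^ᶠ r) ((β ^ᶠ (N / suc q * suc q)) z)      ≡⟨ ^ᶠ-+ r (N / suc q * suc q) z ⟨
        (β ^ᶠ (r + N / suc q * suc q)) z             ≡⟨ cong (λ m → (β ^ᶠ m) z) (m≡m%n+[m/n]*n N (suc q)) ⟨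
        (β ^ᶠ N) z                                   ≡⟨ pN ⟩
        z                                            ∎

    iterates-distinct : ∀ {i k} → i < k → k ≤ q → (β ^ᶠ i) z ≢ (β ^ᶠ k) z
    iterates-distinct {i} {k} i<k k≤q eq with j , 1+i+j≡k ← m≤n⇒∃[o]m+o≡n i<k =
      contradiction (period-difference i (suc j) βⁱ⁺¹⁺ʲz≡βⁱz) (proj₂ least j<q)
      where
      βⁱ⁺¹⁺ʲz≡βⁱz : (β ^ᶠ (i + suc j)) z ≡ (β ^ᶠ i) z
      βⁱ⁺¹⁺ʲz≡βⁱz = trans (cong (λ m → (β ^ᶠ m) z) (trans (+-suc i j) 1+i+j≡k)) (sym eq)
      j<q : j < q
      j<q = ≤-trans (s≤s (m≤n+m j i)) (subst (_≤ q) (sym 1+i+j≡k) k≤q)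

    ∣orbit∣ : ∀ {k} → k ≤ suc q → ∣ orbit z k ∣ ≡ k
    ∣orbit∣ {zero}  _      = ∣⊥∣≡0 n
    ∣orbit∣ {suc k} k<1+q = trans (x∉p⇒∣⁅x⁆∪p∣≡1+∣p∣ fresh) (cong suc (∣orbit∣ (<⇒≤ k<1+q)))
      where
      fresh : (β ^ᶠ k) z ∉ orbit z k
      fresh x∈ with i , i<k , eq ← ∈-orbit⁻ k x∈ = iterates-distinct i<k (s≤s⁻¹ k<1+q) eq

  d∣periods⇒d∣∣T∣ : ∀ d (T : Subset n) → Invariant T →
    (∀ {x k} → x ∈ T → Period x k → d ∣ k) → d ∣ ∣ T ∣
  d∣periods⇒d∣∣T∣ d T = go T (<-wellFounded ∣ T ∣)
    where
    go : ∀ T → Acc _<_ ∣ T ∣ → Invariant T → (∀ {x k} → x ∈ T → Period x k → d ∣ k) → d ∣ ∣ T ∣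
    go T (acc smaller) inv periods-∣ with nonempty? T
    ... | no T-empty = subst (d ∣_) (sym (trans (cong ∣_∣ (Empty-unique T-empty)) (∣⊥∣≡0 n))) (d ∣0)
    ... | yes (z , z∈T) with q , least ← least-period z =
      subst (d ∣_) (sym split)
        (∣m∣n⇒∣m+n (go T′ (smaller T′<T) inv′ (periods-∣ ∘ p─q⊆p T O)) (periods-∣ z∈T (proj₁ least)))
      where
      O = orbit z (suc q)
      T′ = T ─ O
      split : ∣ T ∣ ≡ ∣ T′ ∣ + suc q
      split = trans (∣p∣≡∣p─q∣+∣q∣ (orbit-⊆ inv z∈T (suc q))) (cong (∣ T′ ∣ +_) (∣orbit∣ least ≤-refl))
      T′<T : ∣ T′ ∣ < ∣ T ∣
      T′<T = subst (∣ T′ ∣ <_) (sym split) (m<m+n ∣ T′ ∣ (s≤s z≤n))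
      inv′ : Invariant T′
      inv′ {x} x∈T′ = x∈p∧x∉q⇒x∈p─q (inv (p─q⊆p T O x∈T′))
        (x∈p─q⇒x∉q T O x∈T′ ∘ orbit-closed-β⁻¹ {q = q} (proj₁ least))

module _ {A : Set} (f : A → A) where

  open import Function.Endo.Propositional A using (^-homo) renaming (_^_ to _^ᶠ_)

  3-cycle-period : ∀ {x y z} → f x ≡ y → f y ≡ z → f z ≡ x → x ≢ y → z ≢ x →
    ∀ k → (f ^ᶠ k) x ≡ x → 3 ∣ k
  3-cycle-period _  _  _ _   _   zero             _     = 3 ∣0
  3-cycle-period fx _  _ x≢y _   (suc zero)       fx≡x  = contradiction (trans (sym fx≡x) fx) x≢y
  3-cycle-period fx fy _ _   z≢x (suc (suc zero)) ffx≡x =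
    contradiction (trans (sym (trans (cong f fx) fy)) ffx≡x) z≢x
  3-cycle-period {x} fx fy fz x≢y z≢x (suc (suc (suc k))) eq =
    ∣m∣n⇒∣m+n (∣-refl {3}) (3-cycle-period fx fy fz x≢y z≢x k (trans (sym f³⁺ᵏx≡fᵏx) eq))
    where
    f³x≡x : (f ^ᶠ 3) x ≡ x
    f³x≡x = trans (cong (f ∘ f) fx) (trans (cong f fy) fz)
    f³⁺ᵏx≡fᵏx : (f ^ᶠ (3 + k)) x ≡ (f ^ᶠ k) x
    f³⁺ᵏx≡fᵏx = trans (cong (λ m → (f ^ᶠ m) x) (+-comm 3 k))
                  (trans (cong-app (^-homo f k 3) x) (cong (f ^ᶠ k) f³x≡x))

permutes-triple : ∀ {A : Set} {f : A → A} {a b c} → Injective _≡_ _≡_ f →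
  a ≢ b → a ≢ c → b ≢ c → f b ≡ a ⊎ f b ≡ b ⊎ f b ≡ c → f c ≡ a ⊎ f c ≡ b ⊎ f c ≡ c →
  f a ≡ b → (f b ≡ c × f c ≡ a) ⊎ (f b ≡ a × f c ≡ c)
permutes-triple inj _   _   b≢c (inj₁ fb≡a)        (inj₁ fc≡a)        _    =
  contradiction (inj (trans fb≡a (sym fc≡a))) b≢c
permutes-triple inj _   a≢c _   (inj₁ fb≡a)        (inj₂ (inj₁ fc≡b)) fa≡b =
  contradiction (inj (trans fa≡b (sym fc≡b))) a≢c
permutes-triple _   _   _   _   (inj₁ fb≡a)        (inj₂ (inj₂ fc≡c)) _    = inj₂ (fb≡a , fc≡c)
permutes-triple inj a≢b _   _   (inj₂ (inj₁ fb≡b)) _                  fa≡b =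
  contradiction (inj (trans fa≡b (sym fb≡b))) a≢b
permutes-triple _   _   _   _   (inj₂ (inj₂ fb≡c)) (inj₁ fc≡a)        _    = inj₁ (fb≡c , fc≡a)
permutes-triple inj _   a≢c _   (inj₂ (inj₂ fb≡c)) (inj₂ (inj₁ fc≡b)) fa≡b =
  contradiction (inj (trans fa≡b (sym fc≡b))) a≢c
permutes-triple inj _   _   b≢c (inj₂ (inj₂ fb≡c)) (inj₂ (inj₂ fc≡c)) _    =
  contradiction (inj (trans fb≡c (sym fc≡c))) b≢c

∤2⇒coprime-2 : ∀ {k} → ¬ 2 ∣ k → Coprime k 2
∤2⇒coprime-2 2∤k (i∣k , i∣2) with irreducible[2] i∣2
... | inj₁ i≡1  = i≡1
... | inj₂ refl = contradiction i∣k 2∤k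

∣2^m⇒≡1⊎even : ∀ m {k} → k ∣ 2 ^ m → k ≡ 1 ⊎ 2 ∣ k
∣2^m⇒≡1⊎even zero    k∣1 = inj₁ (∣1⇒≡1 k∣1)
∣2^m⇒≡1⊎even (suc m) {k} k∣2^[1+m] with 2 ∣? k
... | yes 2∣k = inj₂ 2∣k
... | no  2∤k = ∣2^m⇒≡1⊎even m (coprime-divisor (∤2⇒coprime-2 2∤k) k∣2^[1+m])

2^m%3≡1⇒2∣m : ∀ m → 2 ^ m % 3 ≡ 1 → 2 ∣ m
2^m%3≡1⇒2∣m zero          _  = 2 ∣0
2^m%3≡1⇒2∣m (suc zero)    ()
2^m%3≡1⇒2∣m (suc (suc m)) eq =
  ∣m∣n⇒∣m+n (∣-refl {2}) (2^m%3≡1⇒2∣m m (trans (sym 2^[2+m]%3≡2^m%3) eq))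
  where
  4x≡x+x*3 : ∀ x → 2 * (2 * x) ≡ x + x * 3
  4x≡x+x*3 = solve-∀
  2^[2+m]%3≡2^m%3 : 2 ^ (2 + m) % 3 ≡ 2 ^ m % 3
  2^[2+m]%3≡2^m%3 = trans (cong (_% 3) (4x≡x+x*3 (2 ^ m))) ([m+kn]%n≡m%n (2 ^ m) (2 ^ m) 3)

2^m≡1+n⇒3∣n⇒2∣m : ∀ m {n} → 2 ^ m ≡ suc n → 3 ∣ n → 2 ∣ m
2^m≡1+n⇒3∣n⇒2∣m m 2^m≡1+n (divides k refl) =
  2^m%3≡1⇒2∣m m (trans (cong (_% 3) 2^m≡1+n) ([m+kn]%n≡m%n 1 k 3))

module FiniteGroupProperties (G : FiniteGroup) where

  open FiniteGroup G
  open IsGroup isGroup using (assoc; identityˡ; identityʳ; inverseˡ; inverseʳ)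

  group : Group 0ℓ 0ℓ
  group = record { isGroup = isGroup }

  open Algebra.Properties.Group group using (∙-cancelˡ; ∙-cancelʳ; ⁻¹-anti-homo-∙)
  -- `k · x` is the k-th power of x (the library writes monoid powers additively).
  open Algebra.Properties.Monoid.Mult (Group.monoid group) using (×-homo-+) renaming (_×_ to _·_)
  open import Function.Endo.Propositional (Fin order) using () renaming (_^_ to _^ᶠ_)

  conj : Fin order → Fin order → Fin order
  conj g x = (g ∙ x) ∙ (g ⁻¹)

  conj-∙ : ∀ g x y → conj g (x ∙ y) ≡ conj g x ∙ conj g y
  conj-∙ g x y = sym (begin
    ((g ∙ x) ∙ (g ⁻¹)) ∙ ((g ∙ y) ∙ (g ⁻¹))   ≡⟨ assoc ((g ∙ x) ∙ (g ⁻¹)) (g ∙ y) (g ⁻¹) ⟨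
    (((g ∙ x) ∙ (g ⁻¹)) ∙ (g ∙ y)) ∙ (g ⁻¹)   ≡⟨ cong (_∙ (g ⁻¹)) g⁻¹g-cancels ⟩
    ((g ∙ x) ∙ y) ∙ (g ⁻¹)                     ≡⟨ cong (_∙ (g ⁻¹)) (assoc g x y) ⟩
    (g ∙ (x ∙ y)) ∙ (g ⁻¹)                     ∎)
    where
    open ≡-Reasoning
    g⁻¹g-cancels : ((g ∙ x) ∙ (g ⁻¹)) ∙ (g ∙ y) ≡ (g ∙ x) ∙ y
    g⁻¹g-cancels = begin
      ((g ∙ x) ∙ (g ⁻¹)) ∙ (g ∙ y)   ≡⟨ assoc (g ∙ x) (g ⁻¹) (g ∙ y) ⟩
      (g ∙ x) ∙ ((g ⁻¹) ∙ (g ∙ y))   ≡⟨ cong ((g ∙ x) ∙_) (assoc (g ⁻¹) g y) ⟨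
      (g ∙ x) ∙ (((g ⁻¹) ∙ g) ∙ y)   ≡⟨ cong (λ w → (g ∙ x) ∙ (w ∙ y)) (inverseˡ g) ⟩
      (g ∙ x) ∙ (ε ∙ y)              ≡⟨ cong ((g ∙ x) ∙_) (identityˡ y) ⟩
      (g ∙ x) ∙ y                    ∎

  conj-injective : ∀ g → Injective _≡_ _≡_ (conj g)
  conj-injective g eq = ∙-cancelˡ g _ _ (∙-cancelʳ (g ⁻¹) _ _ eq)

  conj-ε : ∀ g → conj g ε ≡ ε
  conj-ε g = trans (cong (_∙ (g ⁻¹)) (identityʳ g)) (inverseʳ g)

  conj-conj : ∀ g h x → conj g (conj h x) ≡ conj (g ∙ h) x
  conj-conj g h x = begin
    (g ∙ ((h ∙ x) ∙ (h ⁻¹))) ∙ (g ⁻¹)   ≡⟨ cong (_∙ (g ⁻¹)) (assoc g (h ∙ x) (h ⁻¹)) ⟨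
    ((g ∙ (h ∙ x)) ∙ (h ⁻¹)) ∙ (g ⁻¹)   ≡⟨ cong (λ w → (w ∙ (h ⁻¹)) ∙ (g ⁻¹)) (assoc g h x) ⟨
    (((g ∙ h) ∙ x) ∙ (h ⁻¹)) ∙ (g ⁻¹)   ≡⟨ assoc ((g ∙ h) ∙ x) (h ⁻¹) (g ⁻¹) ⟩
    ((g ∙ h) ∙ x) ∙ ((h ⁻¹) ∙ (g ⁻¹))   ≡⟨ cong (((g ∙ h) ∙ x) ∙_) (⁻¹-anti-homo-∙ g h) ⟨
    ((g ∙ h) ∙ x) ∙ ((g ∙ h) ⁻¹)         ∎
    where open ≡-Reasoning

  conj-· : ∀ g k x → conj g (k · x) ≡ k · conj g x
  conj-· g zero    x = conj-ε g
  conj-· g (suc k) x = trans (conj-∙ g x (k · x)) (cong (conj g x ∙_) (conj-· g k x))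

  conj^ᶠ-· : ∀ g n k x → (conj g ^ᶠ n) (k · x) ≡ k · (conj g ^ᶠ n) x
  conj^ᶠ-· g zero    k x = refl
  conj^ᶠ-· g (suc n) k x = trans (cong (conj g) (conj^ᶠ-· g n k x)) (conj-· g k _)

  conj-involution : ∀ g {x} → IsInvolution G x → IsInvolution G (conj g x)
  conj-involution g (x≢ε , xx≡ε) =
    (λ gx≡ε → x≢ε (conj-injective g (trans gx≡ε (sym (conj-ε g))))) ,
    trans (sym (conj-∙ g _ _)) (trans (cong (conj g) xx≡ε) (conj-ε g))

  left-translate^ᶠ : ∀ x k z → ((x ∙_) ^ᶠ k) z ≡ (k · x) ∙ z
  left-translate^ᶠ x zero    z = sym (identityˡ z)
  left-translate^ᶠ x (suc k) z = trans (cong (x ∙_) (left-translate^ᶠ x k z)) (sym (assoc x (k · x) z))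

  module _ (x : Fin order) where

    open Orbits (x ∙_) (∙-cancelˡ x _ _)

    period⇒·≡ε : ∀ {z} k → Period z k → k · x ≡ ε
    period⇒·≡ε {z} k per =
      ∙-cancelʳ z _ _ (trans (sym (left-translate^ᶠ x k z)) (trans per (sym (identityˡ z))))

    ·≡ε⇒period : ∀ k → k · x ≡ ε → Period ε k
    ·≡ε⇒period k k·x≡ε = trans (left-translate^ᶠ x k ε) (trans (identityʳ _) k·x≡ε)

    least-period-∣∣H∣ : ∀ {H q} → IsSubgroup G H → x ∈ H → IsLeast (Period ε ∘ suc) q → suc q ∣ ∣ H ∣
    least-period-∣∣H∣ {H} {q} (_ , ∙-closed , _) x∈H least =
      d∣periods⇒d∣∣T∣ (suc q) H (∙-closed x _ x∈H)
        (λ {_} {k} _ per → least-period-∣ least (·≡ε⇒period k (period⇒·≡ε k per)))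

    involution-power : ∀ {H} m → IsSubgroup G H → ∣ H ∣ ≡ 2 ^ m → x ∈ H → x ≢ ε →
      ∃ λ l → IsInvolution G (l · x)
    involution-power {H} m H-subgroup |H|≡2^m x∈H x≢ε
      with q , least ← least-period ε
      with ∣2^m⇒≡1⊎even m (subst (suc q ∣_) |H|≡2^m (least-period-∣∣H∣ H-subgroup x∈H least))
    ... | inj₁ refl = contradiction (trans (sym (identityʳ x)) (period⇒·≡ε (suc q) (proj₁ least))) x≢ε
    ... | inj₂ (divides (suc l) 1+q≡[1+l]*2) = suc l , [1+l]·x≢ε , [1+l]·x²≡ε
      where
      [1+l]*2≡1+[l+[1+l]] : ∀ l → suc l * 2 ≡ suc (l + suc l)
      [1+l]*2≡1+[l+[1+l]] = solve-∀
      q≡l+[1+l] : q ≡ l + suc l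
      q≡l+[1+l] = suc-injective (trans 1+q≡[1+l]*2 ([1+l]*2≡1+[l+[1+l]] l))
      1+l≤q : suc l ≤ q
      1+l≤q = subst (suc l ≤_) (sym q≡l+[1+l]) (m≤n+m (suc l) l)
      [1+l]·x≢ε : suc l · x ≢ ε
      [1+l]·x≢ε eq = contradiction (period≤q⇒≡0 least 1+l≤q (·≡ε⇒period (suc l) eq)) λ ()
      [1+l]·x²≡ε : (suc l · x) ∙ (suc l · x) ≡ ε
      [1+l]·x²≡ε = trans (sym (×-homo-+ x (suc l) (suc l)))
                     (trans (cong (_· x) (cong suc (sym q≡l+[1+l]))) (period⇒·≡ε (suc q) (proj₁ least)))

  record ConjugationCycle : Set where
    field
      g x y z     : Fin order
      x≢y         : x ≢ y
      y≢z         : y ≢ z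
      z≢x         : z ≢ x
      involutions : ∀ w → IsInvolution G w → w ≡ x ⊎ w ≡ y ⊎ w ≡ z
      gx≡y        : conj g x ≡ y
      gy≡z        : conj g y ≡ z
      gz≡x        : conj g z ≡ x

  pertinent⇒conjugationCycle : Pertinent G → ConjugationCycle
  pertinent⇒conjugationCycle ((a , b , c , a-inv , b-inv , c-inv , a≢b , a≢c , b≢c , involutions) , conjugate)
    with g , ga≡b ← conjugate a b a-inv b-inv
    with permutes-triple (conj-injective g) a≢b a≢c b≢c
           (involutions _ (conj-involution g b-inv)) (involutions _ (conj-involution g c-inv)) ga≡b
  ... | inj₁ (gb≡c , gc≡a) = record
    { g = g ; x = a ; y = b ; z = c ; x≢y = a≢b ; y≢z = b≢c ; z≢x = a≢c ∘ sym
    ; involutions = involutions ; gx≡y = ga≡b ; gy≡z = gb≡c ; gz≡x = gc≡a }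
  -- If g is the transposition (a b), a conjugation h with h a ≡ c is either a 3-cycle
  -- or the transposition (a c), and then g ∙ h is a 3-cycle.
  ... | inj₂ (gb≡a , gc≡c)
    with h , ha≡c ← conjugate a c a-inv c-inv
    with permutes-triple (conj-injective h) a≢c a≢b (b≢c ∘ sym)
           (map₂ swap (involutions _ (conj-involution h c-inv)))
           (map₂ swap (involutions _ (conj-involution h b-inv))) ha≡c
  ...   | inj₁ (hc≡b , hb≡a) = record
    { g = h ; x = a ; y = c ; z = b ; x≢y = a≢c ; y≢z = b≢c ∘ sym ; z≢x = a≢b ∘ sym
    ; involutions = λ w → map₂ swap ∘ involutions w ; gx≡y = ha≡c ; gy≡z = hc≡b ; gz≡x = hb≡a }
  ...   | inj₂ (hc≡a , hb≡b) = record
    { g = g ∙ h ; x = a ; y = c ; z = b ; x≢y = a≢c ; y≢z = b≢c ∘ sym ; z≢x = a≢b ∘ sym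
    ; involutions = λ w → map₂ swap ∘ involutions w
    ; gx≡y = via-h ha≡c gc≡c ; gy≡z = via-h hc≡a ga≡b ; gz≡x = via-h hb≡b gb≡a }
    where
    via-h : ∀ {u v w} → conj h u ≡ v → conj g v ≡ w → conj (g ∙ h) u ≡ w
    via-h hu≡v gv≡w = trans (sym (conj-conj g h _)) (trans (cong (conj g) hu≡v) gv≡w)

  3∣∣H-ε∣ : ∀ {H} m → IsNormalSubgroup G H → ∣ H ∣ ≡ 2 ^ m → ConjugationCycle → 3 ∣ ∣ H - ε ∣
  3∣∣H-ε∣ {H} m (H-subgroup , H-normal) |H|≡2^m cycle =
    d∣periods⇒d∣∣T∣ 3 (H - ε) invariant period-divisible
    where
    open ConjugationCycle cycle
    open Orbits (conj g) (conj-injective g)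

    invariant : Invariant (H - ε)
    invariant {u} u∈H-ε with u∈H , u≢ε ← x∈p-y⁻ u∈H-ε =
      x∈p∧x≢y⇒x∈p-y (H-normal g u u∈H) (u≢ε ∘ conj-injective g ∘ flip trans (sym (conj-ε g)))

    powers-fixed : ∀ {u} k → Period u k → ∀ l → Period (l · u) k
    powers-fixed {u} k per l = trans (conj^ᶠ-· g k l u) (cong (l ·_) per)

    involution-period-∣ : ∀ {w k} → IsInvolution G w → Period w k → 3 ∣ k
    involution-period-∣ {w} {k} w-inv per with involutions w w-inv
    ... | inj₁ refl        = 3-cycle-period (conj g) gx≡y gy≡z gz≡x x≢y z≢x k per
    ... | inj₂ (inj₁ refl) = 3-cycle-period (conj g) gy≡z gz≡x gx≡y y≢z x≢y k per
    ... | inj₂ (inj₂ refl) = 3-cycle-period (conj g) gz≡x gx≡y gy≡z z≢x y≢z k per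

    period-divisible : ∀ {u k} → u ∈ H - ε → Period u k → 3 ∣ k
    period-divisible {u} {k} u∈H-ε per
      with u∈H , u≢ε ← x∈p-y⁻ u∈H-ε
      with l , l·u-inv ← involution-power u m H-subgroup |H|≡2^m u∈H u≢ε =
      involution-period-∣ l·u-inv (powers-fixed k per l)

lemma4p3 : (G : FiniteGroup) → Pertinent G →
    (H : Subset (FiniteGroup.order G)) → IsNormalSubgroup G H →
    (m : ℕ) → ∣ H ∣ ≡ 2 ^ m → 2 ∣ m
lemma4p3 G pertinent H H-normal@((ε∈H , _) , _) m |H|≡2^m =
  2^m≡1+n⇒3∣n⇒2∣m m (trans (sym |H|≡2^m) (x∈p⇒∣p∣≡1+∣p-x∣ ε∈H))
    (3∣∣H-ε∣ m H-normal |H|≡2^m (pertinent⇒conjugationCycle pertinent))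
  where open FiniteGroupProperties G using (3∣∣H-ε∣; pertinent⇒conjugationCycle)
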